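{- Let $F$ be a tree topology on $[N]$. For any distinct elements $i,j,k\in[N]$, exactly one of the following holds: $\{i,j\}=_F\{i,k\}$; $\{i,j\}<_F\{i,k\}$; $\{i,k\}<_F\{i,j\}$.
   Context: A tree topology $F$ on $[N]$ is a collection of subsets $S\subseteq[N]$ (clades) with $2\le|S|\le N-1$, such that for any two distinct clades exactly one of $S_1\subsetneq S_2$, $S_2\subsetneq S_1$, $S_1\cap S_2=\emptyset$ holds. For a 2-element subset $p\subseteq[N]$, let $F(p)=\{S\in F: S\supseteq p\}$; the closure $\mathrm{cl}_F(p)$ is the intersection of all clades in $F(p)$ if $F(p)\ne\emptyset$ (this intersection is a clade of $F$), and $\mathrm{cl}_F(p)=[N]$ if $F(p)=\emptyset$. For pairs $p_1,p_2$: $p_1=_F p_2$ iff $\mathrm{cl}_F(p_1)=\mathrm{cl}_F(p_2)$, and $p_1<_F p_2$ iff $\mathrm{cl}_F(p_1)\subsetneq\mathrm{cl}_F(p_2)$. -}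

module Defs where

open import Data.Nat using (ℕ; _≤_; _∸_)
open import Data.Fin using (Fin)
open import Data.Fin.Subset using (Subset; _⊆_; _⊂_; _∩_; _∪_; ⁅_⁆; ⊤; Empty; ∣_∣)
open import Data.Fin.Subset.Properties using (_⊆?_)
open import Data.List using (List; filter; foldr)
open import Data.List.Membership.Propositional using (_∈_)
open import Data.Product using (_×_)
open import Data.Sum using (_⊎_)
open import Relation.Nullary using (¬_)
open import Relation.Binary.PropositionalEquality using (_≡_; _≢_)

ExactlyOne3 : Set → Set → Set → Set
ExactlyOne3 A B C =
  ((A × ¬ B × ¬ C) ⊎ (¬ A × B × ¬ C)) ⊎ (¬ A × ¬ B × C)

record IsTreeTopology (N : ℕ) (F : List (Subset N)) : Set where
  field
    clade-size-lower : ∀ {S} → S ∈ F → 2 ≤ ∣ S ∣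
    clade-size-upper : ∀ {S} → S ∈ F → ∣ S ∣ ≤ N ∸ 1
    laminar : ∀ {S₁ S₂} → S₁ ∈ F → S₂ ∈ F → S₁ ≢ S₂ →
      ExactlyOne3 (S₁ ⊂ S₂) (S₂ ⊂ S₁) (Empty (S₁ ∩ S₂))

pair : ∀ {N} → Fin N → Fin N → Subset N
pair i j = ⁅ i ⁆ ∪ ⁅ j ⁆

cladesAbove : ∀ {N} → List (Subset N) → Subset N → List (Subset N)
cladesAbove F p = filter (p ⊆?_) F

cl : ∀ {N} → List (Subset N) → Subset N → Subset N
cl F p = foldr _∩_ ⊤ (cladesAbove F p)

_=[_]_ : ∀ {N} → Subset N → List (Subset N) → Subset N → Set
p₁ =[ F ] p₂ = cl F p₁ ≡ cl F p₂

_<[_]_ : ∀ {N} → Subset N → List (Subset N) → Subset N → Set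
p₁ <[ F ] p₂ = cl F p₁ ⊂ cl F p₂

-- All clades containing i are pairwise comparable: two of them share i, so they
-- cannot be disjoint and laminarity nests them. The clades above {i, j} therefore
-- form a chain, whose intersection cl F {i, j} is either [N] or one of those
-- clades. Hence cl F {i, j} and cl F {i, k} are comparable under ⊆, and for
-- comparable sets equality and the two strict inclusions are mutually exclusive
-- and exhaustive.
module Submission where

open import Defs
open import Data.Nat using (ℕ)
open import Data.Fin using (Fin)
open import Data.Fin.Subset using (Subset; _∈_; _⊆_; _⊂_; _∩_; ⊤; ⋂)
open import Data.Fin.Subset.Properties
  using (_∈?_; _⊆?_; _⊂?_; ⊆⊤; ⊆-reflexive; ⊆-antisym; ⊂-irref; ⊂-asymmetric;
         p∩q⊆p; p∩q⊆q; x∈p∩q⁺; x∈p∪q⁺; x∈⁅x⁆)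
open import Data.List using (List; _∷_; [])
import Data.List.Membership.Propositional as List
open import Data.List.Membership.Propositional.Properties using (∈-filter⁻)
open import Data.List.Relation.Unary.Any using (here; there)
open import Data.Product using (_,_)
open import Data.Sum using (_⊎_; inj₁; inj₂)
open import Data.Empty using (⊥-elim)
open import Relation.Nullary using (¬_; yes; no)
open import Relation.Binary.PropositionalEquality using (_≡_; _≢_; refl; sym; subst)

private
  variable
    n : ℕ

⊆∧⊄⇒≡ : {p q : Subset n} → p ⊆ q → ¬ p ⊂ q → p ≡ q
⊆∧⊄⇒≡ {p = p} {q} p⊆q p⊄q = ⊆-antisym p⊆q q⊆p
  where
  q⊆p : q ⊆ p
  q⊆p {x} x∈q with x ∈? p
  ... | yes x∈p = x∈p
  ... | no x∉p = ⊥-elim (p⊄q (p⊆q , x , x∈q , x∉p))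

⊆-total⇒⊂-trichotomous : {p q : Subset n} → p ⊆ q ⊎ q ⊆ p →
  ExactlyOne3 (p ≡ q) (p ⊂ q) (q ⊂ p)
⊆-total⇒⊂-trichotomous {p = p} {q} p~q with p ⊂? q | q ⊂? p
... | yes p⊂q | _ = inj₁ (inj₂ ((λ p≡q → ⊂-irref p≡q p⊂q) , p⊂q , ⊂-asymmetric p⊂q))
... | no p⊄q | yes q⊂p = inj₂ ((λ p≡q → ⊂-irref (sym p≡q) q⊂p) , p⊄q , q⊂p)
... | no p⊄q | no q⊄p = inj₁ (inj₁ (p≡q p~q , p⊄q , q⊄p))
  where
  p≡q : p ⊆ q ⊎ q ⊆ p → p ≡ q
  p≡q (inj₁ p⊆q) = ⊆∧⊄⇒≡ p⊆q p⊄q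
  p≡q (inj₂ q⊆p) = sym (⊆∧⊄⇒≡ q⊆p q⊄p)

p⊆q⇒p∩q≡p : {p q : Subset n} → p ⊆ q → p ∩ q ≡ p
p⊆q⇒p∩q≡p {p = p} {q} p⊆q = ⊆-antisym (p∩q⊆p p q) (λ x∈p → x∈p∩q⁺ (x∈p , p⊆q x∈p))

q⊆p⇒p∩q≡q : {p q : Subset n} → q ⊆ p → p ∩ q ≡ q
q⊆p⇒p∩q≡q {p = p} {q} q⊆p = ⊆-antisym (p∩q⊆q p q) (λ x∈q → x∈p∩q⁺ (q⊆p x∈q , x∈q))

Chain : List (Subset n) → Set
Chain G = ∀ {S T} → S List.∈ G → T List.∈ G → S ⊆ T ⊎ T ⊆ S

⋂-chain : (G : List (Subset n)) → Chain G → ⋂ G ≡ ⊤ ⊎ ⋂ G List.∈ G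
⋂-chain [] _ = inj₁ refl
⋂-chain (S ∷ G) chain with ⋂-chain G (λ S∈G T∈G → chain (there S∈G) (there T∈G))
... | inj₁ ⋂G≡⊤ = inj₂ (subst (List._∈ S ∷ G) (sym S∩⋂G≡S) (here refl))
  where
  S∩⋂G≡S : S ∩ ⋂ G ≡ S
  S∩⋂G≡S = p⊆q⇒p∩q≡p (subst (S ⊆_) (sym ⋂G≡⊤) ⊆⊤)
... | inj₂ ⋂G∈G with chain (here refl) (there ⋂G∈G)
...   | inj₁ S⊆⋂G = inj₂ (subst (List._∈ S ∷ G) (sym (p⊆q⇒p∩q≡p S⊆⋂G)) (here refl))
...   | inj₂ ⋂G⊆S = inj₂ (subst (List._∈ S ∷ G) (sym (q⊆p⇒p∩q≡q ⋂G⊆S)) (there ⋂G∈G))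

module _ {F : List (Subset n)} (tree : IsTreeTopology n F) where
  open IsTreeTopology tree

  clades-sharing-element-comparable : ∀ {x S T} → S List.∈ F → T List.∈ F →
    x ∈ S → x ∈ T → S ⊆ T ⊎ T ⊆ S
  clades-sharing-element-comparable {x} {S} {T} S∈F T∈F x∈S x∈T with S ⊆? T
  ... | yes S⊆T = inj₁ S⊆T
  ... | no S⊈T with laminar S∈F T∈F (λ S≡T → S⊈T (⊆-reflexive S≡T))
  ...   | inj₁ (inj₁ ((S⊆T , _) , _)) = inj₁ S⊆T
  ...   | inj₁ (inj₂ (_ , (T⊆S , _) , _)) = inj₂ T⊆S
  ...   | inj₂ (_ , _ , disjoint) = ⊥-elim (disjoint (x , x∈p∩q⁺ (x∈S , x∈T)))

  cladesAbove-chain : ∀ {x p} → x ∈ p → Chain (cladesAbove F p)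
  cladesAbove-chain {p = p} x∈p S∈F[p] T∈F[p]
    with ∈-filter⁻ (p ⊆?_) S∈F[p] | ∈-filter⁻ (p ⊆?_) T∈F[p]
  ... | S∈F , p⊆S | T∈F , p⊆T =
    clades-sharing-element-comparable S∈F T∈F (p⊆S x∈p) (p⊆T x∈p)

  cl-comparable : ∀ {x p q} → x ∈ p → x ∈ q → cl F p ⊆ cl F q ⊎ cl F q ⊆ cl F p
  cl-comparable {x} {p} {q} x∈p x∈q
    with ⋂-chain (cladesAbove F p) (cladesAbove-chain x∈p)
       | ⋂-chain (cladesAbove F q) (cladesAbove-chain x∈q)
  ... | inj₁ clp≡⊤ | _ = inj₂ (subst (cl F q ⊆_) (sym clp≡⊤) ⊆⊤)
  ... | inj₂ _ | inj₁ clq≡⊤ = inj₁ (subst (cl F p ⊆_) (sym clq≡⊤) ⊆⊤)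
  ... | inj₂ clp∈F[p] | inj₂ clq∈F[q]
    with ∈-filter⁻ (p ⊆?_) clp∈F[p] | ∈-filter⁻ (q ⊆?_) clq∈F[q]
  ...   | clp∈F , p⊆clp | clq∈F , q⊆clq =
    clades-sharing-element-comparable clp∈F clq∈F (p⊆clp x∈p) (q⊆clq x∈q)

x∈pair-x : (x y : Fin n) → x ∈ pair x y
x∈pair-x x y = x∈p∪q⁺ (inj₁ (x∈⁅x⁆ x))

lemma4p7 : (N : ℕ) (F : List (Subset N)) → IsTreeTopology N F →
    (i j k : Fin N) → i ≢ j → i ≢ k → j ≢ k →
    ExactlyOne3 (pair i j =[ F ] pair i k)
                (pair i j <[ F ] pair i k)
                (pair i k <[ F ] pair i j)
lemma4p7 N F tree i j k _ _ _ =
  ⊆-total⇒⊂-trichotomous (cl-comparable tree (x∈pair-x i j) (x∈pair-x i k))
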